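{- Let $(a_n)$ be an integer sequence such that the sequence $(n a_n)_{n\ge1}$ is an Euler sequence. Then $(n a_n)$ is an Euler–Gauss sequence. Moreover, for any integer sequence $(b_n)$, the sequence $(n b_n)$ is a Gauss sequence if and only if $b_n=0$ for all $n\ge1$.
   Context: $\mu$ is the Möbius function. An integer sequence $(c_n)$ is an Euler sequence if $c_{p^r}\equiv c_{p^{r-1}}\pmod{p^r}$ for all primes $p$ and integers $r\ge1$; it is Euler–Gauss if for all $n\ge1$, $\prod_{d\mid n,\ \mu(d)=1} c_{n/d}\equiv \prod_{d\mid n,\ \mu(d)=-1} c_{n/d}\pmod n$ (empty products equal $1$); it is a Gauss sequence if $\sum_{d\mid n}\mu(d)c_{n/d}\equiv0\pmod n$ for all $n\ge1$. -}

module Defs where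

open import Data.Nat as ℕ using (ℕ; zero; suc)
open import Data.Nat.Divisibility using (_∣?_)
open import Data.Nat.Primality using (prime?)
open import Data.Integer as ℤ using (ℤ; +_; -_; _-_)
import Data.Integer.Divisibility as ℤD
open import Data.List using (List; []; _∷_; filter; upTo; length; map; foldr)
open import Data.Bool using (if_then_else_)
open import Relation.Nullary.Decidable using (does; _×-dec_)
open import Data.List.Relation.Unary.Any using (any?)

-- integer sequences: functions ℕ → ℤ, only indices n ≥ 1 are relevant

infix 4 _≡_[mod_]
_≡_[mod_] : ℤ → ℤ → ℕ → Set
a ≡ b [mod n ] = (+ n) ℤD.∣ (a - b)

divisors : ℕ → List ℕ
divisors n = filter (λ d → d ∣? n) (map suc (upTo n))

-- n / d with a divisor d; d = 0 never occurs for elements of 'divisors n'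
quot : ℕ → ℕ → ℕ
quot n zero = 0
quot n (suc d) = n ℕ./ suc d

primeDivisors : ℕ → List ℕ
primeDivisors n = filter (λ p → prime? p) (divisors n)


-- has a square factor k² with k ≥ 2 (k ≤ n suffices for n ≥ 1)
-- Möbius function: 0 if n has a square factor, else (-1)^(number of prime factors)
μ : ℕ → ℤ
μ n = if does (any? (λ k → (k ℕ.* k) ∣? n) (map (λ i → 2 ℕ.+ i) (upTo n)))
        then + 0
        else sgn (length (primeDivisors n))
  where
  sgn : ℕ → ℤ
  sgn zero = + 1
  sgn (suc m) = - sgn m

prodℤ : List ℤ → ℤ
prodℤ = foldr ℤ._*_ (+ 1)

sumℤ : List ℤ → ℤ
sumℤ = foldr ℤ._+_ (+ 0)

IsEuler : (ℕ → ℤ) → Set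
IsEuler c = ∀ p r → Data.Nat.Primality.Prime p →
  c (p ℕ.^ suc r) ≡ c (p ℕ.^ r) [mod p ℕ.^ suc r ]

IsEulerGauss : (ℕ → ℤ) → Set
IsEulerGauss c = ∀ n → 1 ℕ.≤ n →
  prodℤ (map (λ d → c (quot n d)) (filter (λ d → μ d ℤ.≟ + 1) (divisors n)))
  ≡ prodℤ (map (λ d → c (quot n d)) (filter (λ d → μ d ℤ.≟ - + 1) (divisors n))) [mod n ]

IsGauss : (ℕ → ℤ) → Set
IsGauss c = ∀ n → 1 ℕ.≤ n →
  sumℤ (map (λ d → μ d ℤ.* c (quot n d)) (divisors n)) ≡ + 0 [mod n ]

{-# OPTIONS --safe #-}
-- If n = p^k, the only divisors of n with μ = 1 and μ = −1 are 1 and p, so the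
-- Euler–Gauss congruence at n is exactly the Euler congruence c_{p^k} ≡ c_{p^{k−1}}.
-- If n has two distinct prime factors p and q, both sides vanish modulo n: the left
-- product contains c_n = n a_n, the right one contains c_{n/p} c_{n/q}, and
-- n ∣ (n/p)(n/q).
--
-- If c_n = n b_n is a Gauss sequence, strong induction shows c_n = 0. Given c_m = 0 for
-- m < n and any prime p, read the Gauss congruence at np modulo p: a term with p ∤ d has
-- p ∣ np/d, a term with d = fp, f ≥ 2, has np/d = n/f < n, so only the term d = p,
-- namely μ(p) c_n = −c_n, survives. Hence every prime divides c_n, and c_n = 0.

module Submission where

open import Defs
open import Data.Empty using (⊥-elim)
open import Data.Integer as ℤ using (ℤ; +_; -_; _*_)
import Data.Integer.Divisibility.Signed as ℤ
import Data.Integer.Properties as ℤ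
open import Data.Integer.Tactic.RingSolver using () renaming (solve-∀ to ℤ-solve-∀)
open import Data.List using (List; []; _∷_; [_]; filter; map; upTo; length)
open import Data.List.Membership.Propositional using (_∈_; lose; find)
open import Data.List.Membership.Propositional.Properties using (∈-map⁺; ∈-map⁻; ∈-upTo⁺; ∈-filter⁺; ∈-filter⁻)
open import Data.List.Relation.Unary.All as All using (All; []; _∷_; all?)
open import Data.List.Relation.Unary.All.Properties using (¬All⇒Any¬)
open import Data.List.Relation.Unary.AllPairs using (_∷_)
open import Data.List.Relation.Unary.Any using (Any; here; there; any?)
open import Data.List.Relation.Unary.Unique.Propositional using (Unique)
import Data.List.Relation.Unary.Unique.Propositional.Properties as Unique
open import Data.Nat as ℕ using (ℕ; zero; suc; _≤_; _<_; s≤s; z≤n; _^_; NonZero)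
open import Data.Nat.DivMod using (m*n/n≡m)
open import Data.Nat.Divisibility
  using (_∣_; _∣?_; divides; ∣-trans; ∣⇒≤; ∣-refl; 1∣_; ∣1⇒≡1; 0∣⇒≡0; _∣0; m∣m*n; n∣m*n; ∣m+n∣m⇒∣n; *-monoˡ-∣)
open import Data.Nat.Induction using (<-rec)
open import Data.Nat.ListAction using (product)
open import Data.Nat.ListAction.Properties using (∈⇒∣product)
open import Data.Nat.Primality
  using (Prime; prime?; prime⇒irreducible; prime⇒nonZero; prime⇒nonTrivial; euclidsLemma)
open import Data.Nat.Primality.Factorisation using (factorise)
import Data.Nat.Properties as ℕ
open import Data.Nat.Tactic.RingSolver using () renaming (solve-∀ to ℕ-solve-∀)
open import Data.Product using (_×_; _,_; proj₂; ∃)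
open import Data.Sum using (_⊎_; inj₁; inj₂)
open import Function.Bundles using (_⇔_; mk⇔)
open import Relation.Binary.PropositionalEquality
  using (_≡_; _≢_; refl; sym; trans; cong; cong₂; subst; subst₂; module ≡-Reasoning)
open import Relation.Nullary using (¬_; yes; no)
open import Relation.Nullary.Decidable using (dec-true; dec-false)
open import Relation.Unary using (Decidable)

private
  variable
    A : Set
    d k n p q : ℕ
    x : A
    xs : List A

unique⇒≡[x] : Unique xs → x ∈ xs → (∀ {y} → y ∈ xs → y ≡ x) → xs ≡ [ x ]
unique⇒≡[x] {xs = y ∷ []} _ _ all≡x = cong [_] (all≡x (here refl))
unique⇒≡[x] {xs = y ∷ z ∷ _} ((y≢z ∷ _) ∷ _) _ all≡x =
  ⊥-elim (y≢z (trans (all≡x (here refl)) (sym (all≡x (there (here refl))))))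

∈⇒∣prodℤ : ∀ (f : A → ℤ) → x ∈ xs → f x ℤ.∣ prodℤ (map f xs)
∈⇒∣prodℤ f (here refl) = ℤ.∣m⇒∣m*n _ ℤ.∣-refl
∈⇒∣prodℤ {xs = y ∷ _} f (there x∈) = ℤ.∣n⇒∣m*n (f y) (∈⇒∣prodℤ f x∈)

∈∧∈⇒*∣prodℤ : ∀ (f : A → ℤ) {y} → x ∈ xs → y ∈ xs → x ≢ y → f x * f y ℤ.∣ prodℤ (map f xs)
∈∧∈⇒*∣prodℤ f (here refl) (here refl) x≢y = ⊥-elim (x≢y refl)
∈∧∈⇒*∣prodℤ f (here refl) (there y∈) _ = ℤ.*-monoʳ-∣ (f _) (∈⇒∣prodℤ f y∈)
∈∧∈⇒*∣prodℤ {xs = z ∷ _} f (there x∈) (here refl) _ =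
  subst (ℤ._∣ _) (ℤ.*-comm (f z) _) (ℤ.*-monoʳ-∣ (f z) (∈⇒∣prodℤ f x∈))
∈∧∈⇒*∣prodℤ {xs = z ∷ _} f (there x∈) (there y∈) x≢y = ℤ.∣n⇒∣m*n (f z) (∈∧∈⇒*∣prodℤ f x∈ y∈ x≢y)

∣sumℤ : ∀ {m} (f : A → ℤ) → (∀ {y} → y ∈ xs → m ℤ.∣ f y) → m ℤ.∣ sumℤ (map f xs)
∣sumℤ {xs = []} f _ = ℤ.∣ᵤ⇒∣ (_ ∣0)
∣sumℤ {xs = x ∷ xs} f m∣f = ℤ.∣m∣n⇒∣m+n (m∣f (here refl)) (∣sumℤ f (λ y∈ → m∣f (there y∈)))

∣sumℤ⇒∣term : ∀ {m} (f : A → ℤ) → Unique xs → x ∈ xs →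
  (∀ {y} → y ∈ xs → y ≢ x → m ℤ.∣ f y) → m ℤ.∣ sumℤ (map f xs) → m ℤ.∣ f x
∣sumℤ⇒∣term f (x∉xs ∷ _) (here refl) m∣others m∣sum =
  ℤ.∣m+n∣n⇒∣m m∣sum (∣sumℤ f (λ {y} y∈ → m∣others (there y∈) (λ y≡x → All.lookup x∉xs y∈ (sym y≡x))))
∣sumℤ⇒∣term f (y∉ys ∷ unique) (there x∈) m∣others m∣sum =
  ∣sumℤ⇒∣term f unique x∈ (λ z∈ → m∣others (there z∈))
    (ℤ.∣m+n∣m⇒∣n m∣sum (m∣others (here refl) (All.lookup y∉ys x∈)))

prime≥2 : Prime p → 2 ≤ p
prime≥2 {p} pp = ℕ.nonTrivial⇒n>1 p {{prime⇒nonTrivial pp}}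

prime∣prime⇒≡ : Prime p → Prime q → q ∣ p → q ≡ p
prime∣prime⇒≡ pp pq q∣p with prime⇒irreducible pp q∣p
... | inj₁ refl = ⊥-elim (ℕ.<-irrefl refl (prime≥2 pq))
... | inj₂ q≡p = q≡p

prime∣p^k⇒≡ : ∀ k → Prime p → Prime q → q ∣ p ^ k → q ≡ p
prime∣p^k⇒≡ zero pp pq q∣1 = ⊥-elim (ℕ.<-irrefl (sym (∣1⇒≡1 q∣1)) (prime≥2 pq))
prime∣p^k⇒≡ {p} (suc k) pp pq q∣p^k with euclidsLemma p (p ^ k) pq q∣p^k
... | inj₁ q∣p = prime∣prime⇒≡ pp pq q∣p
... | inj₂ q∣p^k = prime∣p^k⇒≡ k pp pq q∣p^k

∃prime∣ : 2 ≤ n → ∃ λ p → Prime p × p ∣ n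
∃prime∣ {n@(suc _)} 2≤n with factorise n
... | record { factors = [] ; isFactorisation = n≡1 } = ⊥-elim (ℕ.<-irrefl (sym n≡1) 2≤n)
... | record { factors = p ∷ ps ; isFactorisation = n≡Π ; factorsPrime = pp ∷ _ } =
  p , pp , subst (p ∣_) (sym n≡Π) (m∣m*n (product ps))

divisibleByAllPrimes⇒≡0 : ∀ {m} → (∀ {p} → Prime p → p ∣ m) → m ≡ 0
divisibleByAllPrimes⇒≡0 {zero} _ = refl
divisibleByAllPrimes⇒≡0 {m@(suc _)} p∣m with ∃prime∣ {m ℕ.+ 1} (s≤s (ℕ.m≤n+m 1 _))
... | p , pp , p∣m+1 = ⊥-elim (ℕ.<-irrefl (sym (∣1⇒≡1 (∣m+n∣m⇒∣n p∣m+1 (p∣m pp)))) (prime≥2 pp))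

prime∣divisor-of-p^k : ∀ k → Prime p → 2 ≤ d → d ∣ p ^ k → p ∣ d
prime∣divisor-of-p^k k pp 2≤d d∣p^k with ∃prime∣ 2≤d
... | q , pq , q∣d = subst (_∣ _) (prime∣p^k⇒≡ k pp pq (∣-trans q∣d d∣p^k)) q∣d

divisor-of-p^k : ∀ k → Prime p → d ∣ p ^ k → d ≡ 1 ⊎ d ≡ p ⊎ p ℕ.* p ∣ d
divisor-of-p^k {p} {zero} k pp 0∣p^k =
  ⊥-elim (ℕ.≢-nonZero⁻¹ (p ^ k) {{ℕ.m^n≢0 p k {{prime⇒nonZero pp}}}} (0∣⇒≡0 0∣p^k))
divisor-of-p^k {d = 1} _ _ _ = inj₁ refl
divisor-of-p^k {p} {d@(suc (suc _))} k pp d∣p^k with prime∣divisor-of-p^k k pp (s≤s (s≤s z≤n)) d∣p^k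
... | divides 0 ()
... | divides 1 d≡1*p = inj₂ (inj₁ (trans d≡1*p (ℕ.*-identityˡ p)))
... | divides e@(suc (suc _)) d≡e*p = inj₂ (inj₂ (subst (p ℕ.* p ∣_) (sym d≡e*p) (*-monoˡ-∣ p p∣e)))
  where
  p∣e : p ∣ e
  p∣e = prime∣divisor-of-p^k k pp (s≤s (s≤s z≤n)) (∣-trans (subst (e ∣_) (sym d≡e*p) (m∣m*n p)) d∣p^k)

product-all≡ : ∀ {ps} → All (_≡ p) ps → product ps ≡ p ^ length ps
product-all≡ [] = refl
product-all≡ {p} (refl ∷ all≡p) = cong (p ℕ.*_) (product-all≡ all≡p)

data PrimePowerView : ℕ → Set where
  one        : PrimePowerView 1
  primePower : ∀ {p} k → Prime p → PrimePowerView (p ^ suc k)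
  twoPrimes  : ∀ {n p q} → Prime p → Prime q → p ≢ q → p ∣ n → q ∣ n → PrimePowerView n

primePowerView : ∀ n → .{{NonZero n}} → PrimePowerView n
primePowerView n with factorise n
... | record { factors = [] ; isFactorisation = refl } = one
... | record { factors = p ∷ ps ; isFactorisation = n≡Π ; factorsPrime = pp ∷ pps } with all? (ℕ._≟ p) ps
...   | yes all≡p = subst PrimePowerView (sym (trans n≡Π (cong (p ℕ.*_) (product-all≡ all≡p))))
                          (primePower (length ps) pp)
...   | no ¬all≡p with find (¬All⇒Any¬ (ℕ._≟ p) ps ¬all≡p)
...     | q , q∈ps , q≢p = twoPrimes pp (All.lookup pps q∈ps) (λ p≡q → q≢p (sym p≡q))
                             (subst (p ∣_) (sym n≡Π) (m∣m*n (product ps)))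
                             (subst (q ∣_) (sym n≡Π) (∈⇒∣product {ns = p ∷ ps} (there q∈ps)))

prime∣cofactor⊎cofactor< : Prime p → .{{NonZero n}} → n ℕ.* p ≡ k ℕ.* d → d ≢ p → p ∣ k ⊎ k < n
prime∣cofactor⊎cofactor< {p} {n} {k} {d} pp np≡kd d≢p with p ∣? d
... | yes (divides 0 refl) =
  ⊥-elim (ℕ.≢-nonZero⁻¹ n (ℕ.m*n≡0⇒m≡0 n p {{prime⇒nonZero pp}} (trans np≡kd (ℕ.*-zeroʳ k))))
... | yes (divides 1 d≡1*p) = ⊥-elim (d≢p (trans d≡1*p (ℕ.*-identityˡ p)))
... | yes (divides f@(suc (suc _)) d≡f*p) = inj₂ (k<n k n≡kf)
  where
  n≡kf : n ≡ k ℕ.* f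
  n≡kf = ℕ.*-cancelʳ-≡ n (k ℕ.* f) p {{prime⇒nonZero pp}}
           (trans np≡kd (trans (cong (k ℕ.*_) d≡f*p) (sym (ℕ.*-assoc k f p))))
  k<n : ∀ k → n ≡ k ℕ.* f → k < n
  k<n zero n≡0 = ⊥-elim (ℕ.≢-nonZero⁻¹ n n≡0)
  k<n k@(suc _) n≡kf = subst (k <_) (sym n≡kf) (ℕ.m<m*n k f (s≤s (s≤s z≤n)))
prime∣cofactor⊎cofactor< {p} {n} {k} {d} pp np≡kd d≢p | no p∤d
  with euclidsLemma k d pp (subst (p ∣_) np≡kd (n∣m*n n))
... | inj₁ p∣k = inj₁ p∣k
... | inj₂ p∣d = ⊥-elim (p∤d p∣d)

∣⇒nonZero : .{{NonZero n}} → d ∣ n → NonZero d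
∣⇒nonZero {n} {zero} 0∣n = ⊥-elim (ℕ.≢-nonZero⁻¹ n (0∣⇒≡0 0∣n))
∣⇒nonZero {d = suc _} _ = _

divisors-unique : ∀ n → Unique (divisors n)
divisors-unique n = Unique.filter⁺ (_∣? n) (Unique.map⁺ ℕ.suc-injective (Unique.upTo⁺ n))

∈-divisors⁺ : .{{NonZero n}} → d ∣ n → d ∈ divisors n
∈-divisors⁺ {n} {zero} d∣n = ⊥-elim (ℕ.≢-nonZero⁻¹ n (0∣⇒≡0 d∣n))
∈-divisors⁺ {n} {suc d} d∣n = ∈-filter⁺ (_∣? n) (∈-map⁺ suc (∈-upTo⁺ (∣⇒≤ d∣n))) d∣n

∈-divisors⁻ : d ∈ divisors n → d ∣ n
∈-divisors⁻ {n = n} d∈ = proj₂ (∈-filter⁻ (_∣? n) {xs = map suc (upTo n)} d∈)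

filter-divisors≡[x] : {P : ℕ → Set} (P? : Decidable P) → .{{NonZero n}} →
  d ∣ n → P d → (∀ {e} → e ∣ n → P e → e ≡ d) → filter P? (divisors n) ≡ [ d ]
filter-divisors≡[x] {n} P? d∣n Pd onlyd =
  unique⇒≡[x] (Unique.filter⁺ P? (divisors-unique n)) (∈-filter⁺ P? (∈-divisors⁺ d∣n) Pd) only
  where
  only : ∀ {e} → e ∈ filter P? (divisors n) → e ≡ _
  only e∈ with ∈-filter⁻ P? {xs = divisors n} e∈
  ... | e∈n , Pe = onlyd (∈-divisors⁻ e∈n) Pe

quot-≡ : .{{NonZero d}} → n ≡ q ℕ.* d → quot n d ≡ q
quot-≡ {d = suc d} {q = q} refl = m*n/n≡m q (suc d)

∣quot*quot : Prime p → Prime q → p ≢ q → p ∣ n → q ∣ n → n ∣ quot n p ℕ.* quot n q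
∣quot*quot {p} {q} {n} pp pq p≢q p∣n (divides t n≡t*q) with euclidsLemma t q pp (subst (p ∣_) n≡t*q p∣n)
... | inj₂ p∣q = ⊥-elim (p≢q (prime∣prime⇒≡ pq pp p∣q))
... | inj₁ (divides k t≡k*p) = divides k (begin
  quot n p ℕ.* quot n q   ≡⟨ cong₂ ℕ._*_ (quot-≡ {q = k ℕ.* q} {{prime⇒nonZero pp}} (trans n≡kpq (swap k p q)))
                                          (quot-≡ {q = k ℕ.* p} {{prime⇒nonZero pq}} n≡kpq) ⟩
  (k ℕ.* q) ℕ.* (k ℕ.* p) ≡⟨ rearrange k p q ⟩
  k ℕ.* (k ℕ.* p ℕ.* q)   ≡⟨ cong (k ℕ.*_) n≡kpq ⟨
  k ℕ.* n                 ∎)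
  where
  open ≡-Reasoning
  n≡kpq : n ≡ k ℕ.* p ℕ.* q
  n≡kpq = trans n≡t*q (cong (ℕ._* q) t≡k*p)
  swap : ∀ k p q → k ℕ.* p ℕ.* q ≡ k ℕ.* q ℕ.* p
  swap = ℕ-solve-∀
  rearrange : ∀ k p q → k ℕ.* q ℕ.* (k ℕ.* p) ≡ k ℕ.* (k ℕ.* p ℕ.* q)
  rearrange = ℕ-solve-∀

squareFactor∈ : .{{NonZero d}} → 2 ≤ k → k ℕ.* k ∣ d → Any (λ k → k ℕ.* k ∣ d) (map (2 ℕ.+_) (upTo d))
squareFactor∈ {k = 1} (s≤s ()) _
squareFactor∈ {k = suc (suc i)} _ k²∣d =
  lose (∈-map⁺ (2 ℕ.+_) (∈-upTo⁺ (ℕ.<⇒≤ (ℕ.≤-trans (ℕ.m≤m*n (2 ℕ.+ i) (2 ℕ.+ i)) (∣⇒≤ k²∣d))))) k²∣d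

prime⇒squareFactor∉ : Prime p → ¬ Any (λ k → k ℕ.* k ∣ p) (map (2 ℕ.+_) (upTo p))
prime⇒squareFactor∉ {p} pp k²∣p with find k²∣p
... | k , k∈ , k²∣p with ∈-map⁻ (2 ℕ.+_) k∈ | prime⇒irreducible pp {k} (∣-trans (m∣m*n k) k²∣p)
... | _ , _ , refl | inj₂ refl = ℕ.<⇒≱ (ℕ.m<m*n p p (prime≥2 pp)) (∣⇒≤ {{prime⇒nonZero pp}} k²∣p)

μ-squareful : .{{NonZero d}} → 2 ≤ k → k ℕ.* k ∣ d → μ d ≡ + 0
μ-squareful {d} 2≤k k²∣d
  rewrite dec-true (any? (λ k → k ℕ.* k ∣? d) (map (2 ℕ.+_) (upTo d))) (squareFactor∈ 2≤k k²∣d) = refl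

primeDivisors-prime : Prime p → primeDivisors p ≡ [ p ]
primeDivisors-prime pp =
  filter-divisors≡[x] prime? {{prime⇒nonZero pp}} ∣-refl pp (λ e∣p pe → prime∣prime⇒≡ pp pe e∣p)

μ-prime : Prime p → μ p ≡ - + 1
μ-prime {p} pp
  rewrite dec-false (any? (λ k → k ℕ.* k ∣? p) (map (2 ℕ.+_) (upTo p))) (prime⇒squareFactor∉ pp)
        | primeDivisors-prime pp
        = refl

≡0[mod]⇒∣ : ∀ {x} → x ≡ + 0 [mod n ] → + n ℤ.∣ x
≡0[mod]⇒∣ {x = x} x≡0 = subst (_ ℤ.∣_) (ℤ.+-identityʳ x) (ℤ.∣ᵤ⇒∣ x≡0)

∣⇒≡0[mod] : ∀ {x} → + n ℤ.∣ x → x ≡ + 0 [mod n ]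
∣⇒≡0[mod] {x = x} n∣x = ℤ.∣⇒∣ᵤ (subst (_ ℤ.∣_) (sym (ℤ.+-identityʳ x)) n∣x)

∣∧∣⇒≡[mod] : ∀ {x y} → + n ℤ.∣ x → + n ℤ.∣ y → x ≡ y [mod n ]
∣∧∣⇒≡[mod] n∣x n∣y = ℤ.∣⇒∣ᵤ (ℤ.∣m∣n⇒∣m-n n∣x n∣y)

divisorsWithμ : ℤ → ℕ → List ℕ
divisorsWithμ s n = filter (λ d → μ d ℤ.≟ s) (divisors n)

EulerGaussAt : (ℕ → ℤ) → ℕ → Set
EulerGaussAt c n = prodℤ (map (λ d → c (quot n d)) (divisorsWithμ (+ 1) n))
                 ≡ prodℤ (map (λ d → c (quot n d)) (divisorsWithμ (- + 1) n)) [mod n ]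

∈-divisorsWithμ⁺ : ∀ {s} → .{{NonZero n}} → d ∣ n → μ d ≡ s → d ∈ divisorsWithμ s n
∈-divisorsWithμ⁺ {s = s} d∣n μd≡s = ∈-filter⁺ (λ d → μ d ℤ.≟ s) (∈-divisors⁺ d∣n) μd≡s

module _ {p} (k : ℕ) (pp : Prime p) where

  private instance
    p≢0 : NonZero p
    p≢0 = prime⇒nonZero pp
    p^k≢0 : NonZero (p ^ suc k)
    p^k≢0 = ℕ.m^n≢0 p (suc k)

  μ-squareful-p^k : ∀ {e} → e ∣ p ^ suc k → p ℕ.* p ∣ e → μ e ≡ + 0
  μ-squareful-p^k e∣p^k = μ-squareful {{∣⇒nonZero e∣p^k}} (prime≥2 pp)

  divisorsWithμ[+1]-p^k : divisorsWithμ (+ 1) (p ^ suc k) ≡ [ 1 ]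
  divisorsWithμ[+1]-p^k = filter-divisors≡[x] (λ d → μ d ℤ.≟ + 1) (1∣ _) refl only1
    where
    only1 : ∀ {e} → e ∣ p ^ suc k → μ e ≡ + 1 → e ≡ 1
    only1 e∣p^k μe≡1 with divisor-of-p^k (suc k) pp e∣p^k
    ... | inj₁ e≡1 = e≡1
    ... | inj₂ (inj₁ refl) with trans (sym μe≡1) (μ-prime pp)
    ...   | ()
    only1 e∣p^k μe≡1 | inj₂ (inj₂ p²∣e) with trans (sym μe≡1) (μ-squareful-p^k e∣p^k p²∣e)
    ...   | ()

  divisorsWithμ[-1]-p^k : divisorsWithμ (- + 1) (p ^ suc k) ≡ [ p ]
  divisorsWithμ[-1]-p^k = filter-divisors≡[x] (λ d → μ d ℤ.≟ - + 1) (m∣m*n (p ^ k)) (μ-prime pp) onlyp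
    where
    onlyp : ∀ {e} → e ∣ p ^ suc k → μ e ≡ - + 1 → e ≡ p
    onlyp e∣p^k μe≡-1 with divisor-of-p^k (suc k) pp e∣p^k
    ... | inj₂ (inj₁ e≡p) = e≡p
    ... | inj₁ refl with μe≡-1
    ...   | ()
    onlyp e∣p^k μe≡-1 | inj₂ (inj₂ p²∣e) with trans (sym μe≡-1) (μ-squareful-p^k e∣p^k p²∣e)
    ...   | ()

  eulerGauss-p^k : ∀ c → c (p ^ suc k) ≡ c (p ^ k) [mod p ^ suc k ] → EulerGaussAt c (p ^ suc k)
  eulerGauss-p^k c euler rewrite divisorsWithμ[+1]-p^k | divisorsWithμ[-1]-p^k =
    subst₂ (λ x y → x ≡ y [mod p ^ suc k ])
      (c≡c[quot]*1 1 (ℕ.*-identityʳ _)) (c≡c[quot]*1 p (ℕ.*-comm (p ^ k) p)) euler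
    where
    c≡c[quot]*1 : ∀ d {q} .{{_ : NonZero d}} → q ℕ.* d ≡ p ^ suc k → c q ≡ c (quot (p ^ suc k) d) * + 1
    c≡c[quot]*1 d q*d≡n = trans (cong c (sym (quot-≡ (sym q*d≡n)))) (sym (ℤ.*-identityʳ _))

eulerGauss-twoPrimes : ∀ (a : ℕ → ℤ) → .{{NonZero n}} →
  Prime p → Prime q → p ≢ q → p ∣ n → q ∣ n → EulerGaussAt (λ m → + m * a m) n
eulerGauss-twoPrimes {n} {p} {q} a pp pq p≢q p∣n q∣n = ∣∧∣⇒≡[mod]
  (ℤ.∣-trans n∣term[1] (∈⇒∣prodℤ term (∈-divisorsWithμ⁺ (1∣ n) refl)))
  (ℤ.∣-trans n∣term[p]*term[q]
    (∈∧∈⇒*∣prodℤ term (∈-divisorsWithμ⁺ p∣n (μ-prime pp)) (∈-divisorsWithμ⁺ q∣n (μ-prime pq)) p≢q))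
  where
  term : ℕ → ℤ
  term d = + quot n d * a (quot n d)

  n∣term[1] : + n ℤ.∣ term 1
  n∣term[1] rewrite quot-≡ {d = 1} (sym (ℕ.*-identityʳ n)) = ℤ.∣m⇒∣m*n (a n) ℤ.∣-refl

  n∣term[p]*term[q] : + n ℤ.∣ term p * term q
  n∣term[p]*term[q] = subst (+ n ℤ.∣_) (rearrange (+ quot n p) (+ quot n q) (a (quot n p)) (a (quot n q)))
    (ℤ.∣m⇒∣m*n _ (subst (+ n ℤ.∣_) (ℤ.pos-* (quot n p) (quot n q)) (ℤ.∣ᵤ⇒∣ (∣quot*quot pp pq p≢q p∣n q∣n))))
    where
    rearrange : ∀ u v x y → (u * v) * (x * y) ≡ (u * x) * (v * y)
    rearrange = ℤ-solve-∀

euler⇒eulerGauss : ∀ (a : ℕ → ℤ) → IsEuler (λ n → + n * a n) → IsEulerGauss (λ n → + n * a n)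
euler⇒eulerGauss a euler n 1≤n = eulerGauss-view (primePowerView n)
  where
  instance
    n≢0 : NonZero n
    n≢0 = ℕ.>-nonZero 1≤n

  eulerGauss-view : ∀ {m} .{{_ : NonZero m}} → PrimePowerView m → EulerGaussAt (λ m → + m * a m) m
  eulerGauss-view one = 1∣ _
  eulerGauss-view (primePower k pp) = eulerGauss-p^k k pp (λ m → + m * a m) (euler _ k pp)
  eulerGauss-view (twoPrimes pp pq p≢q p∣m q∣m) = eulerGauss-twoPrimes a pp pq p≢q p∣m q∣m

module _ (b : ℕ → ℤ) where

  private
    c : ℕ → ℤ
    c n = + n * b n

  prime∣n*b[n] : IsGauss c → ∀ n → .{{NonZero n}} → (∀ {m} → m < n → c m ≡ + 0) → Prime p → + p ℤ.∣ c n
  prime∣n*b[n] {p} gauss n below pp =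
    subst (+ p ℤ.∣_) (ℤ.neg-involutive (c n)) (ℤ.∣m⇒∣-m (subst (+ p ℤ.∣_) term[p]≡-c[n] p∣term[p]))
    where
    open ≡-Reasoning
    instance
      p≢0 : NonZero p
      p≢0 = prime⇒nonZero pp
      np≢0 : NonZero (n ℕ.* p)
      np≢0 = ℕ.m*n≢0 n p

    term : ℕ → ℤ
    term d = μ d * c (quot (n ℕ.* p) d)

    p∣sum : + p ℤ.∣ sumℤ (map term (divisors (n ℕ.* p)))
    p∣sum = ℤ.∣-trans (ℤ.∣ᵤ⇒∣ (n∣m*n n)) (≡0[mod]⇒∣ (gauss (n ℕ.* p) (ℕ.>-nonZero⁻¹ _)))

    p∣others : ∀ {d} → d ∈ divisors (n ℕ.* p) → d ≢ p → + p ℤ.∣ term d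
    p∣others {d} d∈ d≢p with ∈-divisors⁻ d∈
    ... | d∣np@(divides k np≡kd) = ℤ.∣n⇒∣m*n (μ d)
      (subst (λ e → + p ℤ.∣ c e) (sym (quot-≡ {{∣⇒nonZero d∣np}} np≡kd))
        (p∣c[k] (prime∣cofactor⊎cofactor< pp np≡kd d≢p)))
      where
      p∣c[k] : p ∣ k ⊎ k < n → + p ℤ.∣ c k
      p∣c[k] (inj₁ p∣k) = ℤ.∣m⇒∣m*n (b k) (ℤ.∣ᵤ⇒∣ {+ p} {+ k} p∣k)
      p∣c[k] (inj₂ k<n) = subst (+ p ℤ.∣_) (sym (below k<n)) (ℤ.∣ᵤ⇒∣ (p ∣0))

    p∣term[p] : + p ℤ.∣ term p
    p∣term[p] = ∣sumℤ⇒∣term term (divisors-unique (n ℕ.* p)) (∈-divisors⁺ (n∣m*n n {p})) p∣others p∣sum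

    term[p]≡-c[n] : term p ≡ - c n
    term[p]≡-c[n] = begin
      μ p * c (quot (n ℕ.* p) p) ≡⟨ cong₂ _*_ (μ-prime pp) (cong c (quot-≡ {d = p} refl)) ⟩
      - + 1 * c n                ≡⟨ ℤ.-1*i≡-i (c n) ⟩
      - c n                      ∎

  gauss⇒n*b[n]≡0 : IsGauss c → ∀ n → c n ≡ + 0
  gauss⇒n*b[n]≡0 gauss = <-rec _ step
    where
    step : ∀ n → (∀ {m} → m < n → c m ≡ + 0) → c n ≡ + 0
    step zero _ = refl
    step n@(suc _) below =
      ℤ.∣i∣≡0⇒i≡0 (divisibleByAllPrimes⇒≡0 (λ pp → ℤ.∣⇒∣ᵤ (prime∣n*b[n] gauss n below pp)))

  gauss⇔≡0 : IsGauss c ⇔ (∀ n → 1 ≤ n → b n ≡ + 0)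
  gauss⇔≡0 = mk⇔ to from
    where
    to : IsGauss c → ∀ n → 1 ≤ n → b n ≡ + 0
    to gauss n@(suc _) _ =
      ℤ.*-cancelˡ-≡ (+ n) (b n) (+ 0) (trans (gauss⇒n*b[n]≡0 gauss n) (sym (ℤ.*-zeroʳ (+ n))))

    from : (∀ n → 1 ≤ n → b n ≡ + 0) → IsGauss c
    from b≡0 n _ = ∣⇒≡0[mod] (∣sumℤ {xs = divisors n} (λ d → μ d * c (quot n d))
      (λ {d} _ → ℤ.∣n⇒∣m*n (μ d) (subst (+ n ℤ.∣_) (sym (c≡0 (quot n d))) (ℤ.∣ᵤ⇒∣ (n ∣0)))))
      where
      c≡0 : ∀ m → c m ≡ + 0
      c≡0 zero = refl
      c≡0 m@(suc _) = trans (cong (+ m *_) (b≡0 m (s≤s z≤n))) (ℤ.*-zeroʳ (+ m))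

theorem4 : ((a : ℕ → ℤ) → IsEuler (λ n → + n * a n) → IsEulerGauss (λ n → + n * a n))
    × ((b : ℕ → ℤ) → IsGauss (λ n → + n * b n) ⇔ (∀ n → 1 ≤ n → b n ≡ + 0))
theorem4 = euler⇒eulerGauss , gauss⇔≡0
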